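{- Let $H$ be a reflexive triangle-free graph, let $C$ be a reflexive cycle with vertices $c_0,c_1,\dots,c_{\ell-1}$ in cyclic order and basepoint $r=c_0$, and let $\phi,\psi:C\to H$ be homomorphisms. Suppose there is a walk $\phi=\phi_1,\phi_2,\dots,\phi_d=\psi$ in $\operatorname{Hom}(C,H)$, and let $W_r=(\phi_1(r),\phi_2(r),\dots,\phi_d(r))$ be the trace of $r$. Then $[\phi(C)]=[\beta_{W_r}(\psi(C))]$ in $\pi(H;\phi(r))$, where $\phi(C)=(\phi(c_0),\phi(c_1),\dots,\phi(c_{\ell-1}),\phi(c_0))$ and similarly for $\psi(C)$.
   Context: A graph is reflexive if every vertex has a loop. A homomorphism $\phi:G\to H$ maps vertices to vertices and edges to edges. The Hom-graph $\operatorname{Hom}(G,H)$ has all homomorphisms $G\to H$ as vertices, with $\phi\sim\psi$ if $\phi(u)\psi(v)\in E(H)$ for every edge $uv$ of $G$. A walk in $H$ is a sequence $(x_0,\dots,x_\ell)$ of vertices with $x_{i-1}x_i\in E(H)$ for all $i$ (consecutive vertices may be equal since $H$ is reflexive); it is an $(a,b)$-walk if $x_0=a,x_\ell=b$, and a closed walk with basepoint $a$ if $a=b$. The concatenation $X\cdot Y$ of an $(a,b)$-walk $X$ and a $(b,c)$-walk $Y$ identifies the last vertex of $X$ with the first vertex of $Y$; $\overleftarrow{X}$ denotes $X$ reversed. For an $(a,b)$-walk $X$ and a closed walk $D$ with basepoint $b$, $\beta_X(D)=X\cdot D\cdot\overleftarrow{X}$. $\Pi(H;a,b)$ is the graph whose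 vertices are the $(a,b)$-walks, where $X=(x_0,\dots,x_\ell)$ and $Y$ are adjacent if (P1) $Y=(x_0,\dots,x_i,x_i,\dots,x_\ell)$ for some $i$ (a vertex is duplicated), or (P2) $Y=(x_0,\dots,x_{i-1},x_i',x_{i+1},\dots,x_\ell)$ for some $0<i<\ell$ with $x_i'\sim x_i$ and $Y$ a walk; adjacency is symmetric. $[X]$ denotes the component of $\Pi(H;a,b)$ containing $X$. $\pi(H;r)$ is the set of components of $\Pi(H;r,r)$, a group under $[X][Y]=[X\cdot Y]$. -}

module Defs where

open import Level using (0ℓ)
open import Data.Nat using (ℕ; zero; suc)
open import Data.Fin using (Fin; toℕ)
open import Data.List using (List; []; _∷_; _++_; drop; reverse; map; allFin; [_])
open import Data.List.Relation.Unary.All using (All)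
open import Data.Product using (_×_; Σ)
open import Data.Sum using (_⊎_)
open import Data.Empty using (⊥)
open import Relation.Nullary using (¬_)
open import Relation.Binary.PropositionalEquality using (_≡_)
open import Relation.Binary.Construct.Closure.ReflexiveTransitive using (Star)

record Graph : Set₁ where
  field
    V   : Set
    E   : V → V → Set
    sym : ∀ {x y} → E x y → E y x

module _ (H : Graph) where
  open Graph H

  Reflexive : Set
  Reflexive = ∀ v → E v v

  TriangleFree : Set
  TriangleFree = ∀ x y z → ¬ x ≡ y → ¬ y ≡ z → ¬ x ≡ z →
                 E x y → E y z → E x z → ⊥

data WalkR {A : Set} (R : A → A → Set) : A → A → List A → Set where
  here : ∀ {x} → WalkR R x x (x ∷ [])
  step : ∀ {x y z ys} → R x y → WalkR R y z ys → WalkR R x z (x ∷ ys)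

-- The reflexive cycle C with ℓ = suc n vertices c₀,…,c_{ℓ-1} = Fin (suc n)

CSucc : (n : ℕ) → Fin (suc n) → Fin (suc n) → Set
CSucc n i j = (suc (toℕ i) ≡ toℕ j) ⊎ ((toℕ i ≡ n) × (toℕ j ≡ 0))

CAdj : (n : ℕ) → Fin (suc n) → Fin (suc n) → Set
CAdj n i j = (i ≡ j) ⊎ (CSucc n i j ⊎ CSucc n j i)

module _ (H : Graph) (n : ℕ) where
  open Graph H

  IsHom : (Fin (suc n) → V) → Set
  IsHom f = ∀ i j → CAdj n i j → E (f i) (f j)

  HomAdj : (Fin (suc n) → V) → (Fin (suc n) → V) → Set
  HomAdj f g = ∀ u v → CAdj n u v → E (f u) (g v)

  imageWalk : (Fin (suc n) → V) → List V
  imageWalk f = map f (allFin (suc n)) ++ [ f Fin.zero ]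
    where import Data.Fin as Fin

-- concatenation X · Y (last vertex of X identified with first vertex of Y)
_·_ : {V : Set} → List V → List V → List V
X · Y = X ++ drop 1 Y

β : {V : Set} → List V → List V → List V
β X D = (X · D) · reverse X

module _ (H : Graph) where
  open Graph H

  data PMove : List V → List V → Set where
    dup  : ∀ pre x post → PMove (pre ++ x ∷ post) (pre ++ x ∷ x ∷ post)
    move : ∀ p pre x x' q post → E x x' →
           PMove ((p ∷ pre) ++ x ∷ q ∷ post) ((p ∷ pre) ++ x' ∷ q ∷ post)

  PiAdj : V → V → List V → List V → Set
  PiAdj a b X Y = WalkR E a b X × WalkR E a b Y × (PMove X Y ⊎ PMove Y X)

  SameComp : V → V → List V → List V → Set
  SameComp a b X Y = WalkR E a b X × WalkR E a b Y × Star (PiAdj a b) X Y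

-- Two adjacent homomorphisms φ ~ ψ : C → H form a ladder: the rails are the closed walks
-- φ(C) and ψ(C), the rungs are the edges ψ(cᵢ)φ(cᵢ), and the diagonals φ(cᵢ)ψ(cᵢ₊₁).
-- Sliding the walk across the ladder one triangle at a time, each slide a single (P2) move,
-- deforms φ(C), after inserting the backtrack (φ(r), ψ(r), φ(r)), into β_{(φ(r),ψ(r))}(ψ(C)).
-- Induction along the walk in Hom(C,H), conjugating by one edge of the trace at each step,
-- gives the theorem.
module Submission where

open import Defs
open import Data.Nat using (ℕ; suc; _≤_)
open import Data.Fin using (Fin; zero)
open import Data.List using (List; _∷_; map)
open import Data.List.Relation.Unary.All using (All)

open import Data.Fin using (inject₁; fromℕ) renaming (suc to fsuc)
open import Data.Fin.Properties using (toℕ-inject₁; toℕ-fromℕ)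
open import Data.List using ([]; [_]; _++_; _∷ʳ_; drop; reverse; tabulate; allFin)
open import Data.List.Properties using (map-++; ++-assoc; ++-identityʳ; unfold-reverse)
open import Data.List.Relation.Unary.All using (_∷_)
open import Data.Product using (_,_)
open import Data.Sum using (inj₁; inj₂)
import Data.Sum as Sum
open import Function using (_∘_)
open import Relation.Binary.PropositionalEquality
  using (_≡_; refl; cong; subst; subst₂; module ≡-Reasoning)
  renaming (sym to ≡-sym)
open import Relation.Binary.Construct.Closure.ReflexiveTransitive
  using (Star; ε; _◅_; _◅◅_; gmap)

walk-map : ∀ {I A : Set} {R : I → I → Set} {S : A → A → Set} (f : I → A) →
           (∀ i j → R i j → S (f i) (f j)) →
           ∀ {i j cs} → WalkR R i j cs → WalkR S (f i) (f j) (map f cs)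
walk-map f hom here       = here
walk-map f hom (step r w) = step (hom _ _ r) (walk-map f hom w)

walk-∷ʳ : ∀ {A : Set} {R : A → A → Set} {a b c X} →
          WalkR R a b X → R b c → WalkR R a c (X ∷ʳ c)
walk-∷ʳ here       r = step r here
walk-∷ʳ (step r w) s = step r (walk-∷ʳ w s)

tabulate-walk : ∀ {A : Set} {R : A → A → Set} m (f : Fin (suc m) → A) {z} →
                (∀ (i : Fin m) → R (f (inject₁ i)) (f (fsuc i))) →
                R (f (fromℕ m)) z → WalkR R (f zero) z (tabulate f ∷ʳ z)
tabulate-walk 0       f next last = step last here
tabulate-walk (suc m) f next last =
  step (next zero) (tabulate-walk m (f ∘ fsuc) (next ∘ fsuc) last)

tour : (n : ℕ) → List (Fin (suc n))
tour n = allFin (suc n) ∷ʳ zero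

tour-walk : ∀ n → WalkR (CAdj n) zero zero (tour n)
tour-walk n = tabulate-walk n (λ i → i) next last
  where
  next : (i : Fin n) → CAdj n (inject₁ i) (fsuc i)
  next i = inj₂ (inj₁ (inj₁ (cong suc (toℕ-inject₁ i))))
  last : CAdj n (fromℕ n) zero
  last = inj₂ (inj₁ (inj₂ (toℕ-fromℕ n , refl)))

imageWalk-tour : ∀ H n (f : Fin (suc n) → Graph.V H) → imageWalk H n f ≡ map f (tour n)
imageWalk-tour H n f = ≡-sym (map-++ f (allFin (suc n)) [ zero ])

drop-1-∷ʳ-++ : ∀ {A : Set} (xs : List A) x ys →
               drop 1 ((xs ∷ʳ x) ++ ys) ≡ drop 1 (xs ∷ʳ x) ++ ys
drop-1-∷ʳ-++ []       x ys = refl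
drop-1-∷ʳ-++ (_ ∷ xs) x ys = refl

β-∷ : ∀ {A : Set} (a b : A) W D → β (a ∷ b ∷ W) D ≡ a ∷ β (b ∷ W) D ∷ʳ a
β-∷ a b W D = cong (a ∷_) (begin
    P ++ drop 1 (reverse (a ∷ b ∷ W))         ≡⟨ cong (λ R → P ++ drop 1 R) (unfold-reverse a (b ∷ W)) ⟩
    P ++ drop 1 (reverse (b ∷ W) ∷ʳ a)        ≡⟨ cong (λ R → P ++ drop 1 (R ∷ʳ a)) (unfold-reverse b W) ⟩
    P ++ drop 1 ((reverse W ∷ʳ b) ∷ʳ a)       ≡⟨ cong (P ++_) (drop-1-∷ʳ-++ (reverse W) b [ a ]) ⟩
    P ++ drop 1 (reverse W ∷ʳ b) ∷ʳ a         ≡⟨ cong (λ R → P ++ drop 1 R ∷ʳ a) (unfold-reverse b W) ⟨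
    P ++ drop 1 (reverse (b ∷ W)) ∷ʳ a        ≡⟨ ++-assoc P _ [ a ] ⟨
    (P ++ drop 1 (reverse (b ∷ W))) ∷ʳ a      ∎)
  where
  open ≡-Reasoning
  P = (b ∷ W) · D

module _ {H : Graph} where
  open Graph H renaming (sym to E-sym)

  PMove-∷ : ∀ {a X Y} → PMove H X Y → PMove H (a ∷ X) (a ∷ Y)
  PMove-∷ {a} (dup pre x post)           = dup (a ∷ pre) x post
  PMove-∷ {a} (move p pre x x' q post e) = move a (p ∷ pre) x x' q post e

  PMove-++ : ∀ {X Y} Z → PMove H X Y → PMove H (X ++ Z) (Y ++ Z)
  PMove-++ Z (dup pre x post) =
    subst₂ (PMove H) (≡-sym (++-assoc pre (x ∷ post) Z)) (≡-sym (++-assoc pre (x ∷ x ∷ post) Z))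
      (dup pre x (post ++ Z))
  PMove-++ Z (move p pre x x' q post e) =
    subst₂ (PMove H) (≡-sym (++-assoc (p ∷ pre) (x ∷ q ∷ post) Z))
      (≡-sym (++-assoc (p ∷ pre) (x' ∷ q ∷ post) Z))
      (move p pre x x' q (post ++ Z) e)

  PiAdj-∷ : ∀ {a b c X Y} → E a b → PiAdj H b c X Y → PiAdj H a c (a ∷ X) (a ∷ Y)
  PiAdj-∷ e (wX , wY , m) = step e wX , step e wY , Sum.map PMove-∷ PMove-∷ m

  PiAdj-∷ʳ : ∀ {b c d X Y} → E c d → PiAdj H b c X Y → PiAdj H b d (X ∷ʳ d) (Y ∷ʳ d)
  PiAdj-∷ʳ {d = d} e (wX , wY , m) =
    walk-∷ʳ wX e , walk-∷ʳ wY e , Sum.map (PMove-++ [ d ]) (PMove-++ [ d ]) m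

  Π-∷ : ∀ {a b c X Y} → E a b → Star (PiAdj H b c) X Y → Star (PiAdj H a c) (a ∷ X) (a ∷ Y)
  Π-∷ e = gmap (_ ∷_) (PiAdj-∷ e)

  Π-conjugate : ∀ {a b X Y} → E a b → Star (PiAdj H b b) X Y →
                Star (PiAdj H a a) (a ∷ X ∷ʳ a) (a ∷ Y ∷ʳ a)
  Π-conjugate {a} e = gmap (λ X → a ∷ X ∷ʳ a) (PiAdj-∷ e ∘ PiAdj-∷ʳ (E-sym e))

  Π-walkʳ : ∀ {a b X Y} → WalkR E a b X → Star (PiAdj H a b) X Y → WalkR E a b Y
  Π-walkʳ wX ε                = wX
  Π-walkʳ _  ((_ , wY , _) ◅ s) = Π-walkʳ wY s

  insert-backtrack : Reflexive H → ∀ {a b c xs} → E a b → WalkR E a c (a ∷ xs) →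
                     Star (PiAdj H a c) (a ∷ xs) (a ∷ b ∷ a ∷ xs)
  insert-backtrack loop {a} {b} {xs = xs} e w =
      (w , aw , inj₁ (dup [] a xs))
    ◅ (aw , step (loop a) aw , inj₁ (dup [] a (a ∷ xs)))
    ◅ (step (loop a) aw , step e (step (E-sym e) w) , inj₁ (move a [] a b a xs e))
    ◅ ε
    where aw = step (loop a) w

  -- Rails x₀…x_k = z and y₀…y_k, with rungs yᵢxᵢ and diagonals xᵢyᵢ₊₁.
  data Ladder (z : V) : List V → List V → Set where
    end  : ∀ {y} → E y z → Ladder z [ z ] [ y ]
    rung : ∀ {x x' y y' xs ys} → E y x → E x x' → E y y' → E x y' →
           Ladder z (x' ∷ xs) (y' ∷ ys) → Ladder z (x ∷ x' ∷ xs) (y ∷ y' ∷ ys)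

  ladder-rung : ∀ {z x xs y ys} → Ladder z (x ∷ xs) (y ∷ ys) → E y x
  ladder-rung (end yz)           = yz
  ladder-rung (rung yx _ _ _ _)  = yx

  ladder-walkˡ : ∀ {z x xs Y} → Ladder z (x ∷ xs) Y → WalkR E x z (x ∷ xs)
  ladder-walkˡ (end _)            = here
  ladder-walkˡ (rung _ xx' _ _ L) = step xx' (ladder-walkˡ L)

  slide-ladder : ∀ {z x xs y ys} → Ladder z (x ∷ xs) (y ∷ ys) →
                 Star (PiAdj H y z) (y ∷ x ∷ xs) (y ∷ ys ∷ʳ z)
  slide-ladder (end _) = ε
  slide-ladder {z} {x} {x' ∷ xs} {y} {y' ∷ ys} L@(rung yx _ yy' xy' L') =
      ( step yx (ladder-walkˡ L)
      , step yy' (step (ladder-rung L') (ladder-walkˡ L'))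
      , inj₁ (move y [] x y' x' xs xy'))
    ◅ Π-∷ yy' (slide-ladder L')

  ladder-conjugate : Reflexive H → ∀ {a b xs ys} → Ladder a (a ∷ xs) (b ∷ ys) →
                     Star (PiAdj H a a) (a ∷ xs) (β (a ∷ b ∷ []) (b ∷ ys))
  ladder-conjugate loop L =
    insert-backtrack loop ab (ladder-walkˡ L) ◅◅ Π-∷ ab (slide-ladder L)
    where ab = E-sym (ladder-rung L)

  module _ {I : Set} {R : I → I → Set} (R-refl : ∀ i → R i i) (f g : I → V)
           (f-hom : ∀ i j → R i j → E (f i) (f j)) (g-hom : ∀ i j → R i j → E (g i) (g j))
           (f~g : ∀ i j → R i j → E (f i) (g j)) where

    rung-at : ∀ i → E (g i) (f i)
    rung-at i = E-sym (f~g i i (R-refl i))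

    -- The two step clauses coincide; splitting on the rest of the walk exposes its head.
    hom-ladder : ∀ {i j cs} → WalkR R i j cs → Ladder (f j) (map f cs) (map g cs)
    hom-ladder here = end (rung-at _)
    hom-ladder (step r w@here) =
      rung (rung-at _) (f-hom _ _ r) (g-hom _ _ r) (f~g _ _ r) (hom-ladder w)
    hom-ladder (step r w@(step _ _)) =
      rung (rung-at _) (f-hom _ _ r) (g-hom _ _ r) (f~g _ _ r) (hom-ladder w)

module _ {H : Graph} {n : ℕ} (loop : Reflexive H) where
  open Graph H using (E)

  imageWalk-walk : ∀ {φ} → IsHom H n φ → WalkR E (φ zero) (φ zero) (imageWalk H n φ)
  imageWalk-walk {φ} hφ =
    subst (WalkR E (φ zero) (φ zero)) (≡-sym (imageWalk-tour H n φ)) (walk-map φ hφ (tour-walk n))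

  adjacent-conjugate : ∀ {φ ψ} → IsHom H n φ → IsHom H n ψ → HomAdj H n φ ψ →
                       Star (PiAdj H (φ zero) (φ zero))
                         (imageWalk H n φ) (β (φ zero ∷ ψ zero ∷ []) (imageWalk H n ψ))
  adjacent-conjugate {φ} {ψ} hφ hψ φ~ψ = ladder-conjugate loop
    (subst₂ (Ladder (φ zero)) (≡-sym (imageWalk-tour H n φ)) (≡-sym (imageWalk-tour H n ψ))
      (hom-ladder (λ _ → inj₁ refl) φ ψ hφ hψ φ~ψ (tour-walk n)))

  trace-step : ∀ {φ φ'} W D → IsHom H n φ → IsHom H n φ' → HomAdj H n φ φ' →
               Star (PiAdj H (φ' zero) (φ' zero)) (imageWalk H n φ') (β (φ' zero ∷ W) D) →
               Star (PiAdj H (φ zero) (φ zero)) (imageWalk H n φ) (β (φ zero ∷ φ' zero ∷ W) D)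
  trace-step {φ} {φ'} W D hφ hφ' φ~φ' s =
    adjacent-conjugate hφ hφ' φ~φ' ◅◅
    subst (Star (PiAdj H (φ zero) (φ zero)) _) (≡-sym (β-∷ (φ zero) (φ' zero) W D))
      (Π-conjugate (φ~φ' zero zero (inj₁ refl)) s)

  trace-conjugate : ∀ {φ ψ L} → WalkR (HomAdj H n) φ ψ L → All (IsHom H n) L →
                    Star (PiAdj H (φ zero) (φ zero))
                      (imageWalk H n φ) (β (map (λ f → f zero) L) (imageWalk H n ψ))
  trace-conjugate here _ = subst (Star _ _) (≡-sym (++-identityʳ _)) ε
  trace-conjugate {ψ = ψ} (step φ~φ' w@here) (hφ ∷ hs@(hφ' ∷ _)) =
    trace-step [] (imageWalk H n ψ) hφ hφ' φ~φ' (trace-conjugate w hs)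
  trace-conjugate {ψ = ψ} (step φ~φ' w@(step {ys = L} _ _)) (hφ ∷ hs@(hφ' ∷ _)) =
    trace-step (map (λ f → f zero) L) (imageWalk H n ψ) hφ hφ' φ~φ' (trace-conjugate w hs)

lemma3p5 : (H : Graph) → Reflexive H → TriangleFree H →
           (n : ℕ) → 2 ≤ n →
           (φ ψ : Fin (suc n) → Graph.V H) →
           IsHom H n φ → IsHom H n ψ →
           (ρ : List (Fin (suc n) → Graph.V H)) →
           All (IsHom H n) ρ →
           WalkR (HomAdj H n) φ ψ (φ ∷ ρ) →
           SameComp H (φ zero) (φ zero)
             (imageWalk H n φ)
             (β (map (λ f → f zero) (φ ∷ ρ)) (imageWalk H n ψ))
lemma3p5 H loop _ n _ φ ψ hφ _ _ hρ walk =
  closed , Π-walkʳ closed path , path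
  where
  closed = imageWalk-walk {H} {n} loop hφ
  path   = trace-conjugate loop walk (hφ ∷ hρ)
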